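{- Let $m\ge2$, let $d\in\mathbb{Z}$ be a non-square and let $R(X_1,\dots,X_m)=X_1^2-dX_2^2$. Let $q_1$ be a product of distinct split primes and $q_2$ a product of distinct inert primes. Then $$\{\mathbf{x}\in\mathbb{Z}^m: R(\mathbf{x})\equiv0\bmod q_1q_2\}\subseteq\bigcup_{\rho\in Z(q_1)}\Lambda(\rho;q_1,q_2).$$ Moreover, for each $\rho\in Z(q_1)$, the largest successive minimum of $\Lambda(\rho;q_1,q_2)$ is $O(q_1^{1/2}q_2)$, with implied constant depending only on $d$.
   Context: A prime $p$ is ramified if $p\mid 2d$; otherwise it is split if $d$ is a square modulo $p$ and inert if $d$ is a non-square modulo $p$. $Z(q_1)=\{\rho\bmod q_1: \rho^2\equiv d\bmod q_1\}$. For $\rho\in Z(q_1)$, $\Lambda(\rho;q_1,q_2)=\{\mathbf{x}\in\mathbb{Z}^m: x_1\equiv\rho x_2\bmod q_1,\ x_1\equiv x_2\equiv0\bmod q_2\}$. Successive minima are taken with respect to the Euclidean norm. -}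

module Defs where

open import Data.Nat as ℕ using (ℕ; zero; suc)
open import Data.Nat.Primality using (Prime)
open import Data.Integer as ℤ using (ℤ; +_; _-_; _*_; _+_; _≤_)
open import Data.Integer.Divisibility using (_∣_)
open import Data.Fin using (Fin; zero; suc)
open import Data.List using (List)
open import Data.Nat.ListAction using (product)
open import Data.List.Relation.Unary.All using (All)
open import Data.List.Relation.Unary.Unique.Propositional using (Unique)
open import Data.Product using (Σ; ∃; _×_)
open import Relation.Nullary using (¬_)
open import Relation.Binary.PropositionalEquality using (_≡_)

_≡_[mod_] : ℤ → ℤ → ℕ → Set
a ≡ b [mod n ] = (+ n) ∣ (a - b)

NonSquare : ℤ → Set
NonSquare d = ¬ (Σ ℤ λ k → k * k ≡ d)

SquareMod : ℤ → ℕ → Set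
SquareMod d p = Σ ℤ λ r → (r * r) ≡ d [mod p ]

Ramified : ℤ → ℕ → Set
Ramified d p = (+ p) ∣ (+ 2 * d)

Split : ℤ → ℕ → Set
Split d p = Prime p × ¬ Ramified d p × SquareMod d p

Inert : ℤ → ℕ → Set
Inert d p = Prime p × ¬ Ramified d p × ¬ SquareMod d p

ProductOfDistinct : (ℕ → Set) → ℕ → Set
ProductOfDistinct P q =
  Σ (List ℕ) λ ps → Unique ps × All P ps × product ps ≡ q

InZ : ℤ → ℕ → ℕ → Set
InZ d q₁ ρ = ρ ℕ.< q₁ × ((+ ρ) * (+ ρ)) ≡ d [mod q₁ ]

Vecℤ : ℕ → Set
Vecℤ m = Fin m → ℤ

x₁ : ∀ {n} → Vecℤ (suc (suc n)) → ℤ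
x₁ x = x zero

x₂ : ∀ {n} → Vecℤ (suc (suc n)) → ℤ
x₂ x = x (suc zero)

R : ℤ → ∀ {n} → Vecℤ (suc (suc n)) → ℤ
R d x = x₁ x * x₁ x - d * (x₂ x * x₂ x)

InΛ : ∀ {n} → ℕ → ℕ → ℕ → Vecℤ (suc (suc n)) → Set
InΛ ρ q₁ q₂ x =
  x₁ x ≡ (+ ρ) * x₂ x [mod q₁ ] × x₁ x ≡ + 0 [mod q₂ ] × x₂ x ≡ + 0 [mod q₂ ]

sumℤ : ∀ {m} → (Fin m → ℤ) → ℤ
sumℤ {zero} f = + 0
sumℤ {suc m} f = f zero + sumℤ (λ i → f (suc i))

normSq : ∀ {m} → Vecℤ m → ℤ
normSq x = sumℤ (λ i → x i * x i)

-- a family of m vectors in ℤ^m is linearly independent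
-- (over ℤ, equivalently over ℚ or ℝ for integer vectors)
LinIndep : ∀ {k m} → (Fin k → Vecℤ m) → Set
LinIndep {k} {m} v =
  (c : Fin k → ℤ) → (∀ j → sumℤ (λ i → c i * v i j) ≡ + 0) → ∀ i → c i ≡ + 0

-- the largest successive minimum of Λ(ρ;q₁,q₂) ⊆ ℤ^m has square at most B:
-- there are m linearly independent lattice vectors of squared norm ≤ B
LastMinSqLe : ∀ {n} → ℕ → ℕ → ℕ → ℤ → Set
LastMinSqLe {n} ρ q₁ q₂ B =
  Σ (Fin (suc (suc n)) → Vecℤ (suc (suc n))) λ v →
    LinIndep v × (∀ i → InΛ ρ q₁ q₂ (v i) × normSq (v i) ≤ B)

{-# OPTIONS --safe #-}

-- Let p be a prime dividing x₁² − d x₂². If p ∣ x₂ then p ∣ x₁; otherwise x₂ is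
-- invertible mod p and r = x₁ x₂⁻¹ satisfies r² ≡ d and x₁ ≡ r x₂. So at a split
-- prime (x₁, x₂) lies on the line of a square root of d, and at an inert prime, where
-- d has no square root, p divides both coordinates. The Chinese remainder theorem
-- assembles these conditions over the distinct primes of q₁ and of q₂.
--
-- For the successive minima, Thue's lemma gives (a, b) ≠ (0, 0) with a ≡ ρ b mod q₁
-- and a², b² ≤ q₁. The vectors q₂(a, b) and q₂(d b, a) lie in Λ(ρ; q₁, q₂), have
-- squared length O(q₁ q₂²), and are independent because their determinant is
-- q₂² (a² − d b²) ≠ 0 for non-square d; the unit vectors e₃, …, e_m complete them.

module Submission where

open import Defs
open import Data.Nat as ℕ using (ℕ; suc; zero; NonZero)
import Data.Nat.Properties as ℕₚ
open import Data.Nat.Coprimality using (Coprime)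
open import Data.Nat.Primality using (Prime)
open import Data.Integer as ℤ using (ℤ; +_)
import Data.Integer.Properties as ℤₚ
open import Data.Product as Product using (Σ; ∃; ∃₂; _×_; _,_; proj₁; proj₂)
open import Data.Sum as Sum using (inj₁; inj₂)
open import Data.Empty using (⊥-elim)
open import Function using (_∘_)
open import Relation.Nullary using (¬_; contradiction; yes; no)
open import Relation.Binary.PropositionalEquality

module PrimeProducts where
  open import Data.Nat.Divisibility using (_∣_; ∣1⇒≡1)
  open import Data.Nat.Primality using (euclidsLemma; prime⇒irreducible; prime⇒nonTrivial; productOfPrimes≢0)
  open import Data.Nat.ListAction using (product)
  open import Data.List using ([]; _∷_)
  open import Data.List.Relation.Unary.All as All using (All; []; _∷_)
  open import Data.List.Relation.Unary.AllPairs.Core using ([]; _∷_)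
  open import Data.List.Relation.Unary.Unique.Propositional using (Unique)

  prime∤⇒coprime : ∀ {p n} → Prime p → ¬ p ∣ n → Coprime p n
  prime∤⇒coprime p-prime p∤n (i∣p , i∣n) with prime⇒irreducible p-prime i∣p
  ... | inj₁ i≡1 = i≡1
  ... | inj₂ refl = contradiction i∣n p∤n

  prime∤product : ∀ {p ps} → Prime p → All Prime ps → All (p ≢_) ps → ¬ p ∣ product ps
  prime∤product {ps = []} p-prime [] [] p∣1 = ℕ.nonTrivial⇒≢1 {{prime⇒nonTrivial p-prime}} (∣1⇒≡1 p∣1)
  prime∤product {ps = q ∷ qs} p-prime (q-prime ∷ qs-prime) (p≢q ∷ p∉qs) p∣q*qs
    with euclidsLemma q (product qs) p-prime p∣q*qs
  ... | inj₂ p∣qs = prime∤product p-prime qs-prime p∉qs p∣qs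
  ... | inj₁ p∣q with prime⇒irreducible q-prime p∣q
  ...   | inj₁ p≡1 = ℕ.nonTrivial⇒≢1 {{prime⇒nonTrivial p-prime}} p≡1
  ...   | inj₂ p≡q = p≢q p≡q

  ProductOfDistinct-induction : ∀ {Q : ℕ → Set} (P : ℕ → Set) → (∀ {p} → Q p → Prime p) →
    P 1 → (∀ {m n} → Coprime m n → P m → P n → P (m ℕ.* n)) → (∀ {p} → Q p → P p) →
    ∀ {q} → ProductOfDistinct Q q → P q
  ProductOfDistinct-induction {Q} P prime P[1] P[*] P[p] (ps , distinct , Q[ps] , refl) = go ps distinct Q[ps]
    where
    go : ∀ ps → Unique ps → All Q ps → P (product ps)
    go [] [] [] = P[1]
    go (p ∷ ps) (p∉ps ∷ distinct) (Q[p] ∷ Q[ps]) =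
      P[*] (prime∤⇒coprime (prime Q[p]) (prime∤product (prime Q[p]) (All.map prime Q[ps]) p∉ps))
           (P[p] Q[p]) (go ps distinct Q[ps])

  ProductOfDistinct⇒NonZero : ∀ {Q : ℕ → Set} → (∀ {p} → Q p → Prime p) →
    ∀ {q} → ProductOfDistinct Q q → NonZero q
  ProductOfDistinct⇒NonZero prime (_ , _ , Q[ps] , refl) = productOfPrimes≢0 (All.map prime Q[ps])

module Squares where
  open import Data.Nat using (_*_; _+_; _≤_; _<_; z≤n; s≤s; _≤?_; ≢-nonZero; ≢-nonZero⁻¹)
  open import Data.Nat.Divisibility using (_∣_; ∣-refl; ∣-trans; m∣m*n; *-cancelʳ-∣)
  open import Data.Nat.DivMod using (_/_; m/n*n≡m)
  open import Data.Nat.GCD using (gcd; gcd[m,n]∣m; gcd[m,n]∣n; gcd[m,n]≢0)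
  open import Data.Nat.Coprimality using (coprime-/gcd; coprime-divisor)
  import Data.Nat.Coprimality as Coprimality
  open import Data.Nat.Tactic.RingSolver using (solve-∀)

  ⌊√⌋-exists : ∀ q → ∃ λ k → k * k ≤ q × q < suc k * suc k
  ⌊√⌋-exists zero = 0 , z≤n , s≤s z≤n
  ⌊√⌋-exists (suc q) with ⌊√⌋-exists q
  ... | k , k²≤q , q<[k+1]² with suc k * suc k ≤? suc q
  ...   | yes [k+1]²≤q+1 =
    suc k , [k+1]²≤q+1 , ℕₚ.≤-<-trans q<[k+1]² (ℕₚ.*-mono-< (ℕₚ.n<1+n (suc k)) (ℕₚ.n<1+n (suc k)))
  ...   | no [k+1]²≰q+1 = k , ℕₚ.m≤n⇒m≤1+n k²≤q , ℕₚ.≰⇒> [k+1]²≰q+1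

  m*m∣n*n⇒m∣n : ∀ {m n} .{{_ : NonZero m}} → m * m ∣ n * n → m ∣ n
  m*m∣n*n⇒m∣n {m} {n} m²∣n² = subst (_∣ n) (sym m≡g) (gcd[m,n]∣m n m)
    where
    open ≡-Reasoning
    g = gcd n m
    instance
      g≢0 : NonZero g
      g≢0 = ≢-nonZero (gcd[m,n]≢0 n m (inj₂ (≢-nonZero⁻¹ m)))
      g²≢0 : NonZero (g * g)
      g²≢0 = ℕₚ.m*n≢0 g g
    m′ = m / g
    n′ = n / g
    square : ∀ {k} → g ∣ k → k * k ≡ k / g * (k / g) * (g * g)
    square {k} g∣k = begin
      k * k                      ≡⟨ cong₂ _*_ (m/n*n≡m g∣k) (m/n*n≡m g∣k) ⟨
      k / g * g * (k / g * g)    ≡⟨ regroup (k / g) g ⟩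
      k / g * (k / g) * (g * g)  ∎
      where
      regroup : ∀ a g → a * g * (a * g) ≡ a * a * (g * g)
      regroup = solve-∀
    m′²∣n′² : m′ * m′ ∣ n′ * n′
    m′²∣n′² = *-cancelʳ-∣ (g * g) m′²g²∣n′²g²
      where
      m′²g²∣n′²g² : m′ * m′ * (g * g) ∣ n′ * n′ * (g * g)
      m′²g²∣n′²g² = subst₂ _∣_ (square (gcd[m,n]∣n n m)) (square (gcd[m,n]∣m n m)) m²∣n²
    m′∣n′ : m′ ∣ n′
    m′∣n′ = coprime-divisor m′⊥n′ (∣-trans (m∣m*n m′) m′²∣n′²)
      where
      m′⊥n′ : Coprime m′ n′
      m′⊥n′ = Coprimality.sym (coprime-/gcd n m)
    m≡g : m ≡ g
    m≡g = begin
      m        ≡⟨ m/n*n≡m (gcd[m,n]∣n n m) ⟨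
      m′ * g   ≡⟨ cong (_* g) (coprime-/gcd n m (m′∣n′ , ∣-refl)) ⟩
      1 * g    ≡⟨ ℕₚ.*-identityˡ g ⟩
      g        ∎

  scale-square-≤ : ∀ {n q} m → n * n ≤ q → m * n * (m * n) ≤ m * m * q
  scale-square-≤ {n} {q} m n²≤q = subst (_≤ m * m * q) (regroup m n) (ℕₚ.*-monoʳ-≤ (m * m) n²≤q)
    where
    regroup : ∀ m n → m * m * (n * n) ≡ m * n * (m * n)
    regroup = solve-∀

  scaled-squares-≤ : ∀ {X Y s t q C} Q → X * X ≤ s * q → Y * Y ≤ t * q → s + t ≤ C →
                     Q * X * (Q * X) + Q * Y * (Q * Y) ≤ C * q * Q * Q
  scaled-squares-≤ {X} {Y} {s} {t} {q} {C} Q X²≤sq Y²≤tq s+t≤C = begin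
    Q * X * (Q * X) + Q * Y * (Q * Y)  ≡⟨ factor Q X Y ⟩
    (X * X + Y * Y) * (Q * Q)          ≤⟨ ℕₚ.*-monoˡ-≤ (Q * Q) (ℕₚ.+-mono-≤ X²≤sq Y²≤tq) ⟩
    (s * q + t * q) * (Q * Q)          ≡⟨ cong (_* (Q * Q)) (ℕₚ.*-distribʳ-+ q s t) ⟨
    (s + t) * q * (Q * Q)              ≤⟨ ℕₚ.*-monoˡ-≤ (Q * Q) (ℕₚ.*-monoˡ-≤ q s+t≤C) ⟩
    C * q * (Q * Q)                    ≡⟨ ℕₚ.*-assoc (C * q) Q Q ⟨
    C * q * Q * Q                      ∎
    where
    open ℕₚ.≤-Reasoning
    factor : ∀ Q X Y → Q * X * (Q * X) + Q * Y * (Q * Y) ≡ (X * X + Y * Y) * (Q * Q)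
    factor = solve-∀

module Congruences where
  open import Data.Integer using (_+_; _-_; -_; _*_; _/_; _%_; 1ℤ)
  open import Data.Integer.Divisibility.Signed
  open import Data.Integer.DivMod using (a≡a%n+[a/n]*n)
  open import Data.Integer.Tactic.RingSolver using (solve-∀)
  open import Data.Nat.Divisibility as ℕ using ()
  open import Data.Nat.Coprimality using (coprime-Bézout; coprime-divisor)
  open import Data.Nat.GCD using (module Bézout)
  open import Data.Nat.Primality using (euclidsLemma)
  open ≡-Reasoning
  open PrimeProducts using (prime∤⇒coprime)

  ∣-lincomb : ∀ {k a b e} x y → k ∣ a → k ∣ b → e ≡ x * a + y * b → k ∣ e
  ∣-lincomb x y k∣a k∣b refl = ∣m∣n⇒∣m+n (∣n⇒∣m*n x k∣a) (∣n⇒∣m*n y k∣b)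

  ∣-multiple : ∀ {k a e} x → k ∣ a → e ≡ x * a → k ∣ e
  ∣-multiple x k∣a refl = ∣n⇒∣m*n x k∣a

  ∣⇒≡0[mod] : ∀ {k a} → + k ∣ a → a ≡ + 0 [mod k ]
  ∣⇒≡0[mod] {k} {a} k∣a = ∣⇒∣ᵤ (subst (+ k ∣_) (sym (ℤₚ.+-identityʳ a)) k∣a)

  ≡0[mod]⇒∣ : ∀ {k a} → a ≡ + 0 [mod k ] → + k ∣ a
  ≡0[mod]⇒∣ {k} {a} a≡0 = subst (+ k ∣_) (ℤₚ.+-identityʳ a) (∣ᵤ⇒∣ a≡0)

  m*n∣⇒m∣ : ∀ m n {a} → + (m ℕ.* n) ∣ a → + m ∣ a
  m*n∣⇒m∣ m n = ∣-trans (∣ᵤ⇒∣ (ℕ.m∣m*n n))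

  m*n∣⇒n∣ : ∀ m n {a} → + (m ℕ.* n) ∣ a → + n ∣ a
  m*n∣⇒n∣ m n = ∣-trans (∣ᵤ⇒∣ (ℕ.n∣m*n m))

  coprime⇒*∣ : ∀ {m n k} → Coprime m n → + m ∣ k → + n ∣ k → + (m ℕ.* n) ∣ k
  coprime⇒*∣ {m} {n} c m∣k n∣k with ∣⇒∣ᵤ n∣k
  ... | ℕ.divides q ∣k∣≡qn = ∣ᵤ⇒∣ (subst (m ℕ.* n ℕ.∣_) (sym ∣k∣≡qn) (ℕ.*-monoˡ-∣ n m∣q))
    where
    m∣q : m ℕ.∣ q
    m∣q = coprime-divisor c (subst (m ℕ.∣_) (trans ∣k∣≡qn (ℕₚ.*-comm q n)) (∣⇒∣ᵤ m∣k))

  prime∣x*x⇒∣x : ∀ {p x} → Prime p → + p ∣ x * x → + p ∣ x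
  prime∣x*x⇒∣x {p} {x} p-prime p∣x*x
    with euclidsLemma ℤ.∣ x ∣ ℤ.∣ x ∣ p-prime (subst (p ℕ.∣_) (ℤₚ.abs-* x x) (∣⇒∣ᵤ p∣x*x))
  ... | inj₁ p∣x = ∣ᵤ⇒∣ p∣x
  ... | inj₂ p∣x = ∣ᵤ⇒∣ p∣x

  %-≡⇒∣- : ∀ x y {n} .{{_ : ℤ.NonZero n}} → x % n ≡ y % n → n ∣ x - y
  %-≡⇒∣- x y {n} x%n≡y%n = divides (x / n - y / n) (begin
    x - y                                              ≡⟨ cong₂ _-_ (a≡a%n+[a/n]*n x n) (a≡a%n+[a/n]*n y n) ⟩
    (+ (x % n) + x / n * n) - (+ (y % n) + y / n * n)  ≡⟨ cong (λ r → (+ (x % n) + x / n * n) - (+ r + y / n * n)) x%n≡y%n ⟨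
    (+ (x % n) + x / n * n) - (+ (x % n) + y / n * n)  ≡⟨ cancel (+ (x % n)) (x / n) (y / n) n ⟩
    (x / n - y / n) * n                                ∎)
    where
    cancel : ∀ r a b n → (r + a * n) - (r + b * n) ≡ (a - b) * n
    cancel = solve-∀

  Invertible : ℕ → ℤ → Set
  Invertible k y = ∃ λ s → + k ∣ s * y - 1ℤ

  pos-a+b*c≡d*e : ∀ a b c d e → a ℕ.+ b ℕ.* c ≡ d ℕ.* e → + a + + b * + c ≡ + d * + e
  pos-a+b*c≡d*e a b c d e eq = begin
    + a + + b * + c     ≡⟨ cong (_+_ (+ a)) (ℤₚ.pos-* b c) ⟨
    + a + + (b ℕ.* c)   ≡⟨ ℤₚ.pos-+ a (b ℕ.* c) ⟨
    + (a ℕ.+ b ℕ.* c)   ≡⟨ cong +_ eq ⟩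
    + (d ℕ.* e)         ≡⟨ ℤₚ.pos-* d e ⟩
    + d * + e           ∎

  coprime⇒invertible : ∀ {m n} → Coprime m n → Invertible m (+ n)
  coprime⇒invertible {m} {n} c with coprime-Bézout c
  ... | Bézout.+- x y 1+yn≡xm = - + y , divides (- + x) (begin
          - + y * + n - 1ℤ      ≡⟨ negate (+ y) (+ n) ⟩
          - (1ℤ + + y * + n)    ≡⟨ cong -_ (pos-a+b*c≡d*e 1 y n x m 1+yn≡xm) ⟩
          - (+ x * + m)         ≡⟨ ℤₚ.neg-distribˡ-* (+ x) (+ m) ⟩
          - + x * + m           ∎)
    where
    negate : ∀ y n → - y * n - 1ℤ ≡ - (1ℤ + y * n)
    negate = solve-∀
  ... | Bézout.-+ x y 1+xm≡yn = + y , divides (+ x) (begin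
          + y * + n - 1ℤ        ≡⟨ cong (_- 1ℤ) (pos-a+b*c≡d*e 1 x m y n 1+xm≡yn) ⟨
          1ℤ + + x * + m - 1ℤ   ≡⟨ cancel (+ x * + m) ⟩
          + x * + m             ∎)
    where
    cancel : ∀ z → 1ℤ + z - 1ℤ ≡ z
    cancel = solve-∀

  prime∤⇒invertible : ∀ {p y} → Prime p → ¬ + p ∣ y → Invertible p y
  prime∤⇒invertible {p} {y} p-prime p∤y
    with coprime⇒invertible (prime∤⇒coprime p-prime (p∤y ∘ ∣ᵤ⇒∣)) | ℤₚ.+∣i∣≡i⊎+∣i∣≡-i y
  ... | s , p∣s∣y∣-1 | inj₁ ∣y∣≡y = s , subst (λ z → + p ∣ s * z - 1ℤ) ∣y∣≡y p∣s∣y∣-1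
  ... | s , p∣s∣y∣-1 | inj₂ ∣y∣≡-y = - s , subst (λ z → + p ∣ z - 1ℤ) s∣y∣≡-s*y p∣s∣y∣-1
    where
    s∣y∣≡-s*y : s * + ℤ.∣ y ∣ ≡ - s * y
    s∣y∣≡-s*y = begin
      s * + ℤ.∣ y ∣   ≡⟨ cong (s *_) ∣y∣≡-y ⟩
      s * - y         ≡⟨ ℤₚ.neg-distribʳ-* s y ⟨
      - (s * y)       ≡⟨ ℤₚ.neg-distribˡ-* s y ⟩
      - s * y         ∎

  chinese-remainder : ∀ {m n} → Coprime m n → ∀ a b → ∃ λ c → + m ∣ c - a × + n ∣ c - b
  chinese-remainder {m} {n} coprime a b with coprime⇒invertible coprime
  ... | t , m∣tn-1 = b + (a - b) * t * + n
                   , ∣-multiple (a - b) m∣tn-1 (off-a a b t (+ n))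
                   , ∣-multiple ((a - b) * t) (∣-refl {+ n}) (off-b b ((a - b) * t) (+ n))
    where
    off-a : ∀ a b t n → b + (a - b) * t * n - a ≡ (a - b) * (t * n - 1ℤ)
    off-a = solve-∀
    off-b : ∀ b u n → b + u * n - b ≡ u * n
    off-b = solve-∀

module NormForm where
  open import Data.Integer using (_-_; _*_; 0ℤ; -[1+_])
  open import Data.Nat.Divisibility as ℕ using ()
  open import Data.Nat.Tactic.RingSolver using (solve-∀)
  open ≡-Reasoning
  open Squares using (m*m∣n*n⇒m∣n)

  norm : ℤ → ℤ → ℤ → ℤ
  norm d x y = x * x - d * (y * y)

  i*i≡+∣i∣*∣i∣ : ∀ i → i * i ≡ + (ℤ.∣ i ∣ ℕ.* ℤ.∣ i ∣)
  i*i≡+∣i∣*∣i∣ (+ n) = sym (ℤₚ.pos-* n n)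
  i*i≡+∣i∣*∣i∣ -[1+ n ] = refl

  a*a≡d*[b*b]⇒square : ∀ {d a b} → b ≢ 0ℤ → a * a ≡ d * (b * b) → Σ ℤ λ c → c * c ≡ d
  a*a≡d*[b*b]⇒square {d} {a} {b} b≢0 a²≡db² = + c , ℤₚ.*-cancelʳ-≡ (+ c * + c) d (+ (B ℕ.* B)) (begin
    + c * + c * + (B ℕ.* B)    ≡⟨ cong (_* + (B ℕ.* B)) (ℤₚ.pos-* c c) ⟨
    + (c ℕ.* c) * + (B ℕ.* B)  ≡⟨ ℤₚ.pos-* (c ℕ.* c) (B ℕ.* B) ⟨
    + (c ℕ.* c ℕ.* (B ℕ.* B))  ≡⟨ cong +_ (regroup c B) ⟩
    + (c ℕ.* B ℕ.* (c ℕ.* B))  ≡⟨ cong (λ z → + (z ℕ.* z)) (ℕ._∣_.equality B∣A) ⟨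
    + (A ℕ.* A)                ≡⟨ i*i≡+∣i∣*∣i∣ a ⟨
    a * a                      ≡⟨ a²≡db² ⟩
    d * (b * b)                ≡⟨ cong (d *_) (i*i≡+∣i∣*∣i∣ b) ⟩
    d * + (B ℕ.* B)            ∎)
    where
    A = ℤ.∣ a ∣
    B = ℤ.∣ b ∣
    instance
      B≢0 : NonZero B
      B≢0 = ℕ.≢-nonZero (b≢0 ∘ ℤₚ.∣i∣≡0⇒i≡0)
      B²≢0 : NonZero (B ℕ.* B)
      B²≢0 = ℕₚ.m*n≢0 B B
    A²≡∣d∣B² : A ℕ.* A ≡ ℤ.∣ d ∣ ℕ.* (B ℕ.* B)
    A²≡∣d∣B² = begin
      A ℕ.* A                  ≡⟨ ℤₚ.abs-* a a ⟨
      ℤ.∣ a * a ∣              ≡⟨ cong ℤ.∣_∣ a²≡db² ⟩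
      ℤ.∣ d * (b * b) ∣        ≡⟨ ℤₚ.abs-* d (b * b) ⟩
      ℤ.∣ d ∣ ℕ.* ℤ.∣ b * b ∣  ≡⟨ cong (ℤ.∣ d ∣ ℕ.*_) (ℤₚ.abs-* b b) ⟩
      ℤ.∣ d ∣ ℕ.* (B ℕ.* B)    ∎
    B∣A : B ℕ.∣ A
    B∣A = m*m∣n*n⇒m∣n (ℕ.divides ℤ.∣ d ∣ A²≡∣d∣B²)
    c = ℕ.quotient B∣A
    regroup : ∀ c B → c ℕ.* c ℕ.* (B ℕ.* B) ≡ c ℕ.* B ℕ.* (c ℕ.* B)
    regroup = solve-∀

  nonsquare⇒norm≢0 : ∀ {d a b} → NonSquare d → ¬ (a ≡ 0ℤ × b ≡ 0ℤ) → norm d a b ≢ 0ℤ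
  nonsquare⇒norm≢0 {d} {a} {b} d-nonsquare nontrivial N≡0 with b ℤₚ.≟ 0ℤ
  ... | no b≢0 = d-nonsquare (a*a≡d*[b*b]⇒square {a = a} b≢0 (ℤₚ.i-j≡0⇒i≡j (a * a) (d * (b * b)) N≡0))
  ... | yes refl = nontrivial (a≡0 , refl)
    where
    a*a≡0 : a * a ≡ 0ℤ
    a*a≡0 = trans (ℤₚ.i-j≡0⇒i≡j (a * a) (d * 0ℤ) N≡0) (ℤₚ.*-zeroʳ d)
    a≡0 : a ≡ 0ℤ
    a≡0 = Sum.reduce (ℤₚ.i*j≡0⇒i≡0∨j≡0 a a*a≡0)

module RootLines where
  open import Data.Integer using (_+_; _-_; -_; _*_; _/_; _%_; 0ℤ; 1ℤ)
  open import Data.Integer.Divisibility.Signed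
  open import Data.Integer.DivMod using (n%d<d; a≡a%n+[a/n]*n)
  open import Data.Integer.Tactic.RingSolver using (solve-∀)
  open import Data.Nat.Divisibility using (1∣_)
  open ≡-Reasoning
  open PrimeProducts
  open Congruences
  open NormForm using (norm)

  -- OnRootLine d k x y r says r ∈ Z(k) and (x, y) ∈ Λ(r; k, 1).
  record OnRootLine (d : ℤ) (k : ℕ) (x y r : ℤ) : Set where
    constructor onRootLine
    field
      root : + k ∣ r * r - d
      line : + k ∣ x - r * y

  RootLine : ℤ → ℕ → ℤ → ℤ → Set
  RootLine d k x y = ∃ (OnRootLine d k x y)

  onRootLine-shift : ∀ {d k x y r} r′ → + k ∣ r′ - r → OnRootLine d k x y r → OnRootLine d k x y r′
  onRootLine-shift {d} {k} {x} {y} {r} r′ k∣r′-r (onRootLine k∣r²-d k∣x-ry) = onRootLine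
    (∣-lincomb (r′ + r) 1ℤ k∣r′-r k∣r²-d (square r′ r d))
    (∣-lincomb (- y) 1ℤ k∣r′-r k∣x-ry (line r′ r x y))
    where
    square : ∀ r′ r d → r′ * r′ - d ≡ (r′ + r) * (r′ - r) + 1ℤ * (r * r - d)
    square = solve-∀
    line : ∀ r′ r x y → x - r′ * y ≡ - y * (r′ - r) + 1ℤ * (x - r * y)
    line = solve-∀

  rootLine-* : ∀ {d m n x y} → Coprime m n → RootLine d m x y → RootLine d n x y → RootLine d (m ℕ.* n) x y
  rootLine-* {d} {m} {n} {x} {y} coprime (r₁ , on₁) (r₂ , on₂) = glue (chinese-remainder coprime r₁ r₂)
    where
    glue : (∃ λ r → + m ∣ r - r₁ × + n ∣ r - r₂) → RootLine d (m ℕ.* n) x y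
    glue (r , m∣r-r₁ , n∣r-r₂) with onRootLine-shift r m∣r-r₁ on₁ | onRootLine-shift r n∣r-r₂ on₂
    ... | onRootLine m∣r²-d m∣x-ry | onRootLine n∣r²-d n∣x-ry =
      r , onRootLine (coprime⇒*∣ coprime m∣r²-d n∣r²-d) (coprime⇒*∣ coprime m∣x-ry n∣x-ry)

  invertible⇒rootLine : ∀ {d k x y} → + k ∣ norm d x y → Invertible k y → RootLine d k x y
  invertible⇒rootLine {d} {k} {x} {y} k∣N (s , k∣sy-1) = x * s , onRootLine
    (∣-lincomb (s * s) (d * (s * y + 1ℤ)) k∣N k∣sy-1 (square x y s d))
    (∣-multiple (- x) k∣sy-1 (line x y s))
    where
    square : ∀ x y s d → x * s * (x * s) - d ≡ s * s * (x * x - d * (y * y)) + d * (s * y + 1ℤ) * (s * y - 1ℤ)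
    square = solve-∀
    line : ∀ x y s → x - x * s * y ≡ - x * (s * y - 1ℤ)
    line = solve-∀

  rootLine⇒squareMod : ∀ {d k x y} → RootLine d k x y → SquareMod d k
  rootLine⇒squareMod (r , onRootLine k∣r²-d _) = r , ∣⇒∣ᵤ k∣r²-d

  prime∣norm⇒∣y⇒∣x : ∀ {d p x y} → Prime p → + p ∣ norm d x y → + p ∣ y → + p ∣ x
  prime∣norm⇒∣y⇒∣x {d} {p} {x} {y} p-prime p∣N p∣y =
    prime∣x*x⇒∣x p-prime (∣-lincomb 1ℤ d p∣N (∣n⇒∣m*n y p∣y) (x² x y d))
    where
    x² : ∀ x y d → x * x ≡ 1ℤ * (x * x - d * (y * y)) + d * (y * y)
    x² = solve-∀

  split⇒rootLine : ∀ {d p x y} → Split d p → + p ∣ norm d x y → RootLine d p x y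
  split⇒rootLine {d} {p} {x} {y} (p-prime , _ , r , r²≡d) p∣N with + p ∣? y
  ... | yes p∣y =
    r , onRootLine (∣ᵤ⇒∣ r²≡d) (∣m∣n⇒∣m-n (prime∣norm⇒∣y⇒∣x {d} {x = x} p-prime p∣N p∣y) (∣n⇒∣m*n r p∣y))
  ... | no p∤y = invertible⇒rootLine p∣N (prime∤⇒invertible p-prime p∤y)

  inert⇒∣x∣y : ∀ {d p x y} → Inert d p → + p ∣ norm d x y → + p ∣ x × + p ∣ y
  inert⇒∣x∣y {d} {p} {x} {y} (p-prime , _ , d-nonsquare) p∣N with + p ∣? y
  ... | yes p∣y = prime∣norm⇒∣y⇒∣x {d} {x = x} p-prime p∣N p∣y , p∣y
  ... | no p∤y =
    contradiction (rootLine⇒squareMod (invertible⇒rootLine {x = x} p∣N (prime∤⇒invertible p-prime p∤y))) d-nonsquare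

  splitProduct⇒rootLine : ∀ {d q x y} → ProductOfDistinct (Split d) q → + q ∣ norm d x y → RootLine d q x y
  splitProduct⇒rootLine {d} {x = x} {y} =
    ProductOfDistinct-induction (λ k → + k ∣ norm d x y → RootLine d k x y) proj₁
      (λ _ → 0ℤ , onRootLine (∣ᵤ⇒∣ (1∣ _)) (∣ᵤ⇒∣ (1∣ _)))
      (λ {m} {n} coprime P[m] P[n] mn∣N → rootLine-* coprime (P[m] (m*n∣⇒m∣ m n mn∣N)) (P[n] (m*n∣⇒n∣ m n mn∣N)))
      split⇒rootLine

  inertProduct⇒∣x∣y : ∀ {d q x y} → ProductOfDistinct (Inert d) q → + q ∣ norm d x y → + q ∣ x × + q ∣ y
  inertProduct⇒∣x∣y {d} {x = x} {y} =
    ProductOfDistinct-induction (λ k → + k ∣ norm d x y → + k ∣ x × + k ∣ y) proj₁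
      (λ _ → ∣ᵤ⇒∣ (1∣ _) , ∣ᵤ⇒∣ (1∣ _))
      (λ {m} {n} coprime P[m] P[n] mn∣N →
        Product.zip (coprime⇒*∣ coprime) (coprime⇒*∣ coprime) (P[m] (m*n∣⇒m∣ m n mn∣N)) (P[n] (m*n∣⇒n∣ m n mn∣N)))
      inert⇒∣x∣y

  rootLine-reduce : ∀ {d k x y} .{{_ : NonZero k}} → RootLine d k x y → Σ ℕ λ ρ → ρ ℕ.< k × OnRootLine d k x y (+ ρ)
  rootLine-reduce {k = k} (r , on) = ρ , n%d<d r (+ k) , onRootLine-shift (+ ρ) k∣ρ-r on
    where
    ρ = r % + k
    k∣ρ-r : + k ∣ + ρ - r
    k∣ρ-r = ∣-multiple (- (r / + k)) ∣-refl (begin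
      + ρ - r                       ≡⟨ cong (_-_ (+ ρ)) (a≡a%n+[a/n]*n r (+ k)) ⟩
      + ρ - (+ ρ + r / + k * + k)   ≡⟨ cancel (+ ρ) (r / + k) (+ k) ⟩
      - (r / + k) * + k             ∎)
      where
      cancel : ∀ a b n → a - (a + b * n) ≡ - b * n
      cancel = solve-∀

  covering : ∀ {d n q₁ q₂} → ProductOfDistinct (Split d) q₁ → ProductOfDistinct (Inert d) q₂ →
    (x : Vecℤ (suc (suc n))) → R d x ≡ + 0 [mod q₁ ℕ.* q₂ ] → Σ ℕ λ ρ → InZ d q₁ ρ × InΛ ρ q₁ q₂ x
  covering {d} {q₁ = q₁} {q₂} split inert x R≡0 =
    conclude
      (rootLine-reduce {{ProductOfDistinct⇒NonZero proj₁ split}} (splitProduct⇒rootLine split (m*n∣⇒m∣ q₁ q₂ q₁q₂∣R)))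
      (inertProduct⇒∣x∣y inert (m*n∣⇒n∣ q₁ q₂ q₁q₂∣R))
    where
    q₁q₂∣R = ≡0[mod]⇒∣ R≡0
    conclude : Σ ℕ (λ ρ → ρ ℕ.< q₁ × OnRootLine d q₁ (x₁ x) (x₂ x) (+ ρ)) → + q₂ ∣ x₁ x × + q₂ ∣ x₂ x →
               Σ ℕ λ ρ → InZ d q₁ ρ × InΛ ρ q₁ q₂ x
    conclude (ρ , ρ<q₁ , onRootLine q₁∣ρ²-d q₁∣x₁-ρx₂) q₂∣x =
      ρ , (ρ<q₁ , ∣⇒∣ᵤ q₁∣ρ²-d) , ∣⇒∣ᵤ q₁∣x₁-ρx₂ , Product.map ∣⇒≡0[mod] ∣⇒≡0[mod] q₂∣x

module Thue where
  open import Data.Integer using (_-_; _*_; 0ℤ; 1ℤ)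
  open import Data.Integer.Divisibility.Signed using (_∣_)
  open import Data.Integer.DivMod using (n%d<d)
  open import Data.Integer.Tactic.RingSolver using (solve-∀)
  open import Data.Fin using (Fin; toℕ; fromℕ<; remQuot; combine)
  import Data.Fin.Properties as Finₚ
  open ≡-Reasoning
  open Squares using (⌊√⌋-exists)
  open Congruences using (∣-multiple; %-≡⇒∣-)

  remQuot-injective : ∀ {m} n {i j : Fin (m ℕ.* n)} → remQuot {m} n i ≡ remQuot n j → i ≡ j
  remQuot-injective {m} n {i} {j} eq = begin
    i                                          ≡⟨ Finₚ.combine-remQuot {m} n i ⟨
    Product.uncurry combine (remQuot {m} n i)  ≡⟨ cong (Product.uncurry combine) eq ⟩
    Product.uncurry combine (remQuot {m} n j)  ≡⟨ Finₚ.combine-remQuot {m} n j ⟩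
    j                                          ∎

  pigeonhole² : ∀ {k q} → q ℕ.< k ℕ.* k → (f : Fin k × Fin k → Fin q) → ∃₂ λ u v → u ≢ v × f u ≡ f v
  pigeonhole² {k} q<k² f with Finₚ.pigeonhole q<k² (f ∘ remQuot {k} k)
  ... | i , j , i<j , fi≡fj = remQuot {k} k i , remQuot k j , Finₚ.<⇒≢ i<j ∘ remQuot-injective {k} k , fi≡fj

  ∣toℕ-toℕ∣≤ : ∀ {k} (i j : Fin (suc k)) → ℤ.∣ + toℕ i - + toℕ j ∣ ℕ.≤ k
  ∣toℕ-toℕ∣≤ i j = subst (ℕ._≤ _) (sym (cong ℤ.∣_∣ (ℤₚ.m-n≡m⊖n (toℕ i) (toℕ j))))
    (ℕₚ.≤-trans (ℤₚ.∣m⊝n∣≤m⊔n (toℕ i) (toℕ j)) (ℕₚ.⊔-lub (Finₚ.toℕ≤pred[n] i) (Finₚ.toℕ≤pred[n] j)))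

  toℕ-toℕ≡0⇒≡ : ∀ {k} {i j : Fin k} → + toℕ i - + toℕ j ≡ 0ℤ → i ≡ j
  toℕ-toℕ≡0⇒≡ eq = Finₚ.toℕ-injective (ℤₚ.+-injective (ℤₚ.i-j≡0⇒i≡j _ _ eq))

  record SmallSolution (q : ℕ) (ρ : ℤ) : Set where
    field
      a b : ℤ
      nontrivial : ¬ (a ≡ 0ℤ × b ≡ 0ℤ)
      a²≤q : ℤ.∣ a ∣ ℕ.* ℤ.∣ a ∣ ℕ.≤ q
      b²≤q : ℤ.∣ b ∣ ℕ.* ℤ.∣ b ∣ ℕ.≤ q
      a≡ρb : + q ∣ a - ρ * b

  residue : ∀ q .{{_ : NonZero q}} (ρ : ℤ) {k} → Fin k × Fin k → Fin q
  residue q ρ (i , j) = fromℕ< (n%d<d (+ toℕ i - ρ * + toℕ j) (+ q))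

  -- The (⌊√q⌋ + 1)² pairs (i, j) with 0 ≤ i, j ≤ ⌊√q⌋ outnumber the residues of
  -- i − ρ j mod q; the difference of two colliding pairs is the solution.
  thue : ∀ q .{{_ : NonZero q}} ρ → SmallSolution q ρ
  thue q ρ with ⌊√⌋-exists q
  ... | k , k²≤q , q<[k+1]² with pigeonhole² q<[k+1]² (residue q ρ)
  ...   | (i , j) , (i′ , j′) , ij≢i′j′ , same-residue = record
    { a = + toℕ i - + toℕ i′
    ; b = + toℕ j - + toℕ j′
    ; nontrivial = λ (a≡0 , b≡0) → ij≢i′j′ (cong₂ _,_ (toℕ-toℕ≡0⇒≡ a≡0) (toℕ-toℕ≡0⇒≡ b≡0))
    ; a²≤q = ≤k⇒²≤q (∣toℕ-toℕ∣≤ i i′)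
    ; b²≤q = ≤k⇒²≤q (∣toℕ-toℕ∣≤ j j′)
    ; a≡ρb = ∣-multiple 1ℤ q∣difference (regroup (+ toℕ i) (+ toℕ i′) (+ toℕ j) (+ toℕ j′) ρ)
    }
    where
    ≤k⇒²≤q : ∀ {x} → x ℕ.≤ k → x ℕ.* x ℕ.≤ q
    ≤k⇒²≤q x≤k = ℕₚ.≤-trans (ℕₚ.*-mono-≤ x≤k x≤k) k²≤q
    q∣difference : + q ∣ (+ toℕ i - ρ * + toℕ j) - (+ toℕ i′ - ρ * + toℕ j′)
    q∣difference =
      %-≡⇒∣- (+ toℕ i - ρ * + toℕ j) (+ toℕ i′ - ρ * + toℕ j′) (Finₚ.fromℕ<-injective _ _ _ _ same-residue)
    regroup : ∀ i i′ j j′ ρ → (i - i′) - ρ * (j - j′) ≡ 1ℤ * ((i - ρ * j) - (i′ - ρ * j′))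
    regroup = solve-∀

module PlaneBasis where
  open import Data.Integer using (_+_; _-_; -_; _*_; _≤_; +≤+; 0ℤ; 1ℤ)
  open import Data.Integer.Divisibility.Signed
  open import Data.Integer.Tactic.RingSolver using (solve-∀)
  open import Data.Fin using (Fin; zero; suc)
  open ≡-Reasoning
  open Squares using (scale-square-≤; scaled-squares-≤)
  open Congruences using (∣-lincomb; ∣-multiple; ∣⇒≡0[mod])
  open NormForm using (i*i≡+∣i∣*∣i∣; nonsquare⇒norm≢0)
  open Thue using (SmallSolution; thue)

  e : ∀ {m} → Fin m → Vecℤ m
  e zero    zero    = 1ℤ
  e zero    (suc _) = 0ℤ
  e (suc _) zero    = 0ℤ
  e (suc i) (suc j) = e i j

  pad : ∀ {n} → ℤ → ℤ → Vecℤ (suc (suc n))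
  pad x y zero          = x
  pad x y (suc zero)    = y
  pad x y (suc (suc _)) = 0ℤ

  planeBasis : ∀ {n} → Vecℤ (suc (suc n)) → Vecℤ (suc (suc n)) → Fin (suc (suc n)) → Vecℤ (suc (suc n))
  planeBasis u w zero            = u
  planeBasis u w (suc zero)      = w
  planeBasis u w i@(suc (suc _)) = e i

  sumℤ-zero : ∀ {m} (f : Fin m → ℤ) → (∀ i → f i ≡ 0ℤ) → sumℤ f ≡ 0ℤ
  sumℤ-zero {zero}  f f≡0 = refl
  sumℤ-zero {suc m} f f≡0 = cong₂ _+_ (f≡0 zero) (sumℤ-zero (f ∘ suc) (f≡0 ∘ suc))

  sumℤ-*e : ∀ {m} (c : Fin m → ℤ) j → sumℤ (λ i → c i * e i j) ≡ c j
  sumℤ-*e {suc m} c zero = begin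
    c zero * 1ℤ + sumℤ (λ i → c (suc i) * 0ℤ)  ≡⟨ cong₂ _+_ (ℤₚ.*-identityʳ (c zero)) (sumℤ-zero _ (ℤₚ.*-zeroʳ ∘ c ∘ suc)) ⟩
    c zero + 0ℤ                                ≡⟨ ℤₚ.+-identityʳ (c zero) ⟩
    c zero                                     ∎
  sumℤ-*e {suc m} c (suc j) = begin
    c zero * 0ℤ + sumℤ (λ i → c (suc i) * e i j)  ≡⟨ cong₂ _+_ (ℤₚ.*-zeroʳ (c zero)) (sumℤ-*e (c ∘ suc) j) ⟩
    0ℤ + c (suc j)                                ≡⟨ ℤₚ.+-identityˡ (c (suc j)) ⟩
    c (suc j)                                     ∎

  normSq-e : ∀ {m} (j : Fin m) → normSq (e j) ≡ 1ℤ
  normSq-e {suc m} zero    = cong (_+_ 1ℤ) (sumℤ-zero {m} _ (λ _ → refl))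
  normSq-e {suc m} (suc j) = trans (ℤₚ.+-identityˡ _) (normSq-e j)

  normSq-pad : ∀ {n} x y → normSq (pad {n} x y) ≡ + (ℤ.∣ x ∣ ℕ.* ℤ.∣ x ∣ ℕ.+ ℤ.∣ y ∣ ℕ.* ℤ.∣ y ∣)
  normSq-pad {n} x y = begin
    x * x + (y * y + sumℤ {n} (λ _ → 0ℤ))              ≡⟨ cong (λ z → x * x + (y * y + z)) (sumℤ-zero {n} _ (λ _ → refl)) ⟩
    x * x + (y * y + 0ℤ)                               ≡⟨ cong (_+_ (x * x)) (ℤₚ.+-identityʳ (y * y)) ⟩
    x * x + y * y                                      ≡⟨ cong₂ _+_ (i*i≡+∣i∣*∣i∣ x) (i*i≡+∣i∣*∣i∣ y) ⟩
    + (ℤ.∣ x ∣ ℕ.* ℤ.∣ x ∣) + + (ℤ.∣ y ∣ ℕ.* ℤ.∣ y ∣)  ≡⟨ ℤₚ.pos-+ (ℤ.∣ x ∣ ℕ.* ℤ.∣ x ∣) (ℤ.∣ y ∣ ℕ.* ℤ.∣ y ∣) ⟨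
    + (ℤ.∣ x ∣ ℕ.* ℤ.∣ x ∣ ℕ.+ ℤ.∣ y ∣ ℕ.* ℤ.∣ y ∣)    ∎

  normSq-scaled-pad-≤ : ∀ {n} Q x y {s t q C} →
    ℤ.∣ x ∣ ℕ.* ℤ.∣ x ∣ ℕ.≤ s ℕ.* q → ℤ.∣ y ∣ ℕ.* ℤ.∣ y ∣ ℕ.≤ t ℕ.* q → s ℕ.+ t ℕ.≤ C →
    normSq (pad {n} (+ Q * x) (+ Q * y)) ≤ + (C ℕ.* q ℕ.* Q ℕ.* Q)
  normSq-scaled-pad-≤ {n} Q x y {s} {t} x²≤sq y²≤tq s+t≤C =
    subst (_≤ _) (sym normSq≡) (+≤+ (scaled-squares-≤ {s = s} {t} Q x²≤sq y²≤tq s+t≤C))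
    where
    normSq≡ : normSq (pad {n} (+ Q * x) (+ Q * y)) ≡
              + (Q ℕ.* ℤ.∣ x ∣ ℕ.* (Q ℕ.* ℤ.∣ x ∣) ℕ.+ Q ℕ.* ℤ.∣ y ∣ ℕ.* (Q ℕ.* ℤ.∣ y ∣))
    normSq≡ = trans (normSq-pad {n} (+ Q * x) (+ Q * y))
                    (cong₂ (λ X Y → + (X ℕ.* X ℕ.+ Y ℕ.* Y)) (ℤₚ.abs-* (+ Q) x) (ℤₚ.abs-* (+ Q) y))

  sumℤ-planeBasis-head : ∀ {n} u w (γ : Fin (suc (suc n)) → ℤ) j → (∀ i → e {suc (suc n)} (suc (suc i)) j ≡ 0ℤ) →
    sumℤ (λ i → γ i * planeBasis u w i j) ≡ γ zero * u j + γ (suc zero) * w j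
  sumℤ-planeBasis-head u w γ j e[2+i]j≡0 = begin
    γ zero * u j + (γ (suc zero) * w j + sumℤ (λ i → γ (suc (suc i)) * e (suc (suc i)) j))
      ≡⟨ cong (λ z → γ zero * u j + (γ (suc zero) * w j + z)) rest≡0 ⟩
    γ zero * u j + (γ (suc zero) * w j + 0ℤ)
      ≡⟨ cong (_+_ (γ zero * u j)) (ℤₚ.+-identityʳ _) ⟩
    γ zero * u j + γ (suc zero) * w j
      ∎
    where
    rest≡0 : sumℤ (λ i → γ (suc (suc i)) * e (suc (suc i)) j) ≡ 0ℤ
    rest≡0 = sumℤ-zero _ (λ i → trans (cong (γ (suc (suc i)) *_) (e[2+i]j≡0 i)) (ℤₚ.*-zeroʳ (γ (suc (suc i)))))

  sumℤ-planeBasis-tail : ∀ {n} a b c f (γ : Fin (suc (suc n)) → ℤ) j →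
    sumℤ (λ i → γ i * planeBasis (pad a b) (pad c f) i (suc (suc j))) ≡ γ (suc (suc j))
  sumℤ-planeBasis-tail a b c f γ j = begin
    γ zero * 0ℤ + (γ (suc zero) * 0ℤ + sumℤ (λ i → γ (suc (suc i)) * e i j))  ≡⟨ drop-zeros (γ zero) (γ (suc zero)) _ ⟩
    sumℤ (λ i → γ (suc (suc i)) * e i j)                                      ≡⟨ sumℤ-*e (λ i → γ (suc (suc i))) j ⟩
    γ (suc (suc j))                                                           ∎
    where
    drop-zeros : ∀ x y z → x * 0ℤ + (y * 0ℤ + z) ≡ z
    drop-zeros = solve-∀

  nonsingular-2×2 : ∀ a b c f γ₀ γ₁ → a * f - b * c ≢ 0ℤ →
    γ₀ * a + γ₁ * c ≡ 0ℤ → γ₀ * b + γ₁ * f ≡ 0ℤ → γ₀ ≡ 0ℤ × γ₁ ≡ 0ℤ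
  nonsingular-2×2 a b c f γ₀ γ₁ det≢0 first≡0 second≡0 =
    ≡0-of-*det γ₀ (begin
      γ₀ * (a * f - b * c)                           ≡⟨ eliminate₁ γ₀ γ₁ a b c f ⟩
      f * (γ₀ * a + γ₁ * c) - c * (γ₀ * b + γ₁ * f)  ≡⟨ cong₂ (λ u v → f * u - c * v) first≡0 second≡0 ⟩
      f * 0ℤ - c * 0ℤ                                ≡⟨ zeros f c ⟩
      0ℤ                                             ∎) ,
    ≡0-of-*det γ₁ (begin
      γ₁ * (a * f - b * c)                           ≡⟨ eliminate₂ γ₀ γ₁ a b c f ⟩
      a * (γ₀ * b + γ₁ * f) - b * (γ₀ * a + γ₁ * c)  ≡⟨ cong₂ (λ u v → a * u - b * v) second≡0 first≡0 ⟩
      a * 0ℤ - b * 0ℤ                                ≡⟨ zeros a b ⟩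
      0ℤ                                             ∎)
    where
    ≡0-of-*det : ∀ x → x * (a * f - b * c) ≡ 0ℤ → x ≡ 0ℤ
    ≡0-of-*det x x*det≡0 = Sum.fromInj₁ (⊥-elim ∘ det≢0) (ℤₚ.i*j≡0⇒i≡0∨j≡0 x x*det≡0)
    eliminate₁ : ∀ γ₀ γ₁ a b c f → γ₀ * (a * f - b * c) ≡ f * (γ₀ * a + γ₁ * c) - c * (γ₀ * b + γ₁ * f)
    eliminate₁ = solve-∀
    eliminate₂ : ∀ γ₀ γ₁ a b c f → γ₁ * (a * f - b * c) ≡ a * (γ₀ * b + γ₁ * f) - b * (γ₀ * a + γ₁ * c)
    eliminate₂ = solve-∀
    zeros : ∀ u v → u * 0ℤ - v * 0ℤ ≡ 0ℤ
    zeros = solve-∀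

  planeBasis-linIndep : ∀ {n} a b c f → a * f - b * c ≢ 0ℤ → LinIndep (planeBasis {n} (pad a b) (pad c f))
  planeBasis-linIndep {n} a b c f det≢0 γ combination≡0 = γ≡0
    where
    coordinate : ∀ j → (∀ i → e {suc (suc n)} (suc (suc i)) j ≡ 0ℤ) →
                 γ zero * pad {n} a b j + γ (suc zero) * pad {n} c f j ≡ 0ℤ
    coordinate j e[2+i]j≡0 = trans (sym (sumℤ-planeBasis-head (pad a b) (pad c f) γ j e[2+i]j≡0)) (combination≡0 j)
    γ₀≡0×γ₁≡0 : γ zero ≡ 0ℤ × γ (suc zero) ≡ 0ℤ
    γ₀≡0×γ₁≡0 = nonsingular-2×2 a b c f (γ zero) (γ (suc zero)) det≢0
                  (coordinate zero (λ _ → refl)) (coordinate (suc zero) (λ _ → refl))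
    γ≡0 : ∀ i → γ i ≡ 0ℤ
    γ≡0 zero          = proj₁ γ₀≡0×γ₁≡0
    γ≡0 (suc zero)    = proj₂ γ₀≡0×γ₁≡0
    γ≡0 (suc (suc j)) = trans (sym (sumℤ-planeBasis-tail a b c f γ j)) (combination≡0 (suc (suc j)))

  scaled∈Λ : ∀ {n ρ q₁ q₂ x y} → + q₁ ∣ x - + ρ * y → InΛ ρ q₁ q₂ (pad {n} (+ q₂ * x) (+ q₂ * y))
  scaled∈Λ {ρ = ρ} {q₂ = q₂} {x} {y} q₁∣x-ρy =
    ∣⇒∣ᵤ (∣-multiple (+ q₂) q₁∣x-ρy (factor (+ q₂) x y (+ ρ))) ,
    ∣⇒≡0[mod] (∣m⇒∣m*n x ∣-refl) ,
    ∣⇒≡0[mod] (∣m⇒∣m*n y ∣-refl)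
    where
    factor : ∀ Q x y r → Q * x - r * (Q * y) ≡ Q * (x - r * y)
    factor = solve-∀

  e∈Λ : ∀ {n ρ q₁ q₂} j → InΛ ρ q₁ q₂ (e {suc (suc n)} (suc (suc j)))
  e∈Λ {ρ = ρ} {q₁} _ =
    ∣⇒∣ᵤ {+ q₁} (divides 0ℤ (vanish (+ ρ) (+ q₁))) , ∣⇒≡0[mod] (divides 0ℤ refl) , ∣⇒≡0[mod] (divides 0ℤ refl)
    where
    vanish : ∀ r q → 0ℤ - r * 0ℤ ≡ 0ℤ * q
    vanish = solve-∀

  *-pres-≢0 : ∀ {i j} → i ≢ 0ℤ → j ≢ 0ℤ → i * j ≢ 0ℤ
  *-pres-≢0 {i} i≢0 j≢0 ij≡0 = Sum.[ i≢0 , j≢0 ] (ℤₚ.i*j≡0⇒i≡0∨j≡0 i ij≡0)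

  -- (d b, a) is (a, b) multiplied by √d in ℤ[√d], so it stays on the line x₁ ≡ ρ x₂
  -- because ρ² ≡ d; the bound uses a², b² ≤ q₁, whence the constant 2 + d².
  short-basis : ∀ {d n q₁ q₂ ρ} .{{_ : NonZero q₁}} .{{_ : NonZero q₂}} → NonSquare d → InZ d q₁ ρ →
    LastMinSqLe {n} ρ q₁ q₂ (+ ((2 ℕ.+ ℤ.∣ d ∣ ℕ.* ℤ.∣ d ∣) ℕ.* q₁ ℕ.* q₂ ℕ.* q₂))
  short-basis {d} {n} {q₁} {q₂} {ρ} d-nonsquare (_ , ρ²≡d) = V , planeBasis-linIndep u₁ u₂ w₁ w₂ det≢0 , short
    where
    open SmallSolution (thue q₁ (+ ρ))
    Q = + q₂
    D = ℤ.∣ d ∣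
    C = 2 ℕ.+ D ℕ.* D
    u₁ = Q * a
    u₂ = Q * b
    w₁ = Q * (d * b)
    w₂ = Q * a
    V = planeBasis {n} (pad u₁ u₂) (pad w₁ w₂)
    det≢0 : u₁ * w₂ - u₂ * w₁ ≢ 0ℤ
    det≢0 = subst (_≢ 0ℤ) (factor Q a b d)
      (*-pres-≢0 Q≢0 (*-pres-≢0 Q≢0 (nonsquare⇒norm≢0 {a = a} d-nonsquare nontrivial)))
      where
      Q≢0 : Q ≢ 0ℤ
      Q≢0 Q≡0 = ℕ.≢-nonZero⁻¹ q₂ (ℤₚ.+-injective Q≡0)
      factor : ∀ Q a b d → Q * (Q * (a * a - d * (b * b))) ≡ Q * a * (Q * a) - Q * b * (Q * (d * b))
      factor = solve-∀
    db≡ρa : + q₁ ∣ d * b - + ρ * a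
    db≡ρa = ∣-lincomb (- + ρ) (- b) a≡ρb (∣ᵤ⇒∣ ρ²≡d) (rotate (+ ρ) a b d)
      where
      rotate : ∀ r a b d → d * b - r * a ≡ - r * (a - r * b) + - b * (r * r - d)
      rotate = solve-∀
    ≤1*q₁ : ∀ {x} → x ℕ.≤ q₁ → x ℕ.≤ 1 ℕ.* q₁
    ≤1*q₁ {x} = subst (x ℕ.≤_) (sym (ℕₚ.*-identityˡ q₁))
    [db]²≤D²q₁ : ℤ.∣ d * b ∣ ℕ.* ℤ.∣ d * b ∣ ℕ.≤ D ℕ.* D ℕ.* q₁
    [db]²≤D²q₁ = subst (λ z → z ℕ.* z ℕ.≤ D ℕ.* D ℕ.* q₁) (sym (ℤₚ.abs-* d b)) (scale-square-≤ D b²≤q)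
    1≤Cq₁q₂² : 1 ℕ.≤ C ℕ.* q₁ ℕ.* q₂ ℕ.* q₂
    1≤Cq₁q₂² = ℕ.>-nonZero⁻¹ _ {{ℕₚ.m*n≢0 _ q₂ {{ℕₚ.m*n≢0 _ q₂ {{ℕₚ.m*n≢0 C q₁}}}}}}
    short : ∀ i → InΛ ρ q₁ q₂ (V i) × normSq (V i) ≤ + (C ℕ.* q₁ ℕ.* q₂ ℕ.* q₂)
    short zero =
      scaled∈Λ {n} {ρ} a≡ρb ,
      normSq-scaled-pad-≤ {n} q₂ a b {1} {1} (≤1*q₁ a²≤q) (≤1*q₁ b²≤q) (ℕₚ.m≤m+n 2 (D ℕ.* D))
    short (suc zero) =
      scaled∈Λ {n} {ρ} db≡ρa ,
      normSq-scaled-pad-≤ {n} q₂ (d * b) a {D ℕ.* D} {1} [db]²≤D²q₁ (≤1*q₁ a²≤q)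
        (subst (ℕ._≤ C) (ℕₚ.+-comm 1 (D ℕ.* D)) (ℕₚ.n≤1+n _))
    short (suc (suc j)) = e∈Λ {ρ = ρ} j , subst (_≤ _) (sym (normSq-e (suc (suc j)))) (+≤+ 1≤Cq₁q₂²)

open import Data.Nat using (_*_)
open PrimeProducts using (ProductOfDistinct⇒NonZero)
open RootLines using (covering)
open PlaneBasis using (short-basis)

lemma5p1 : (d : ℤ) → NonSquare d →
    Σ ℕ λ C →
      (n : ℕ) → (q₁ q₂ : ℕ) →
      ProductOfDistinct (Split d) q₁ → ProductOfDistinct (Inert d) q₂ →
        ((x : Vecℤ (suc (suc n))) → R d x ≡ + 0 [mod q₁ * q₂ ] →
           Σ ℕ λ ρ → InZ d q₁ ρ × InΛ ρ q₁ q₂ x)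
        ×
        ((ρ : ℕ) → InZ d q₁ ρ →
           LastMinSqLe {n} ρ q₁ q₂ (+ (C * q₁ * q₂ * q₂)))
lemma5p1 d d-nonsquare = 2 ℕ.+ ℤ.∣ d ∣ * ℤ.∣ d ∣ , λ n q₁ q₂ split inert →
  covering split inert ,
  λ ρ ρ∈Z → short-basis {{ProductOfDistinct⇒NonZero proj₁ split}} {{ProductOfDistinct⇒NonZero proj₁ inert}}
                        d-nonsquare ρ∈Z
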